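{- A map $\phi:S\to\mathbb Z$ is odd dominant if and only if every pair $s_1<s_2$ of consecutive elements of $S$ is $\phi$-regular.
   Context: $p\ge7$ is prime, $k_0\in\{2,\dots,p\}$, and $S=\{\lceil\frac{k_0+1}2\rceil,\lceil\frac{k_0+1}2\rceil+1,\dots,\lfloor\frac{k_0-4+p}2\rfloor\}$. For $\phi:S\to\mathbb Z$, a pair of indices $s<s'$ in $S$ is $\phi$-regular if (a) $|\phi(s)-\phi(s')|\le1$ and (b) if $\phi(s)\neq\phi(s')$ then $\phi(s')$ is odd. $\phi$ is odd dominant if every pair $s<s'$ in $S$ is $\phi$-regular. -}

module Defs where

open import Data.Nat using (ℕ; suc; _+_; _∸_; _≤_; _<_)
open import Data.Nat.DivMod using (_/_)
open import Data.Integer as ℤ using (ℤ; ∣_∣; _-_)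
open import Data.Product using (Σ; ∃; _×_; proj₁)
open import Relation.Binary.PropositionalEquality using (_≡_; _≢_)

-- lower end ⌈(k₀+1)/2⌉ = ⌊(k₀+2)/2⌋
lowS : ℕ → ℕ
lowS k₀ = (k₀ + 2) / 2

-- upper end ⌊(k₀-4+p)/2⌋ (k₀ + p ≥ 9 under the standing hypotheses, so ∸ is exact)
highS : ℕ → ℕ → ℕ
highS p k₀ = (k₀ + p ∸ 4) / 2

InS : ℕ → ℕ → ℕ → Set
InS p k₀ s = lowS k₀ ≤ s × s ≤ highS p k₀

S : ℕ → ℕ → Set
S p k₀ = Σ ℕ (InS p k₀)

OddInt : ℤ → Set
OddInt z = ∃ λ (k : ℤ) → z ≡ ℤ.+ 1 ℤ.+ ℤ.+ 2 ℤ.* k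

Regular : ∀ {p k₀} → (S p k₀ → ℤ) → S p k₀ → S p k₀ → Set
Regular φ s s' = (∣ φ s - φ s' ∣ ≤ 1) × (φ s ≢ φ s' → OddInt (φ s'))

OddDominant : ∀ {p k₀} → (S p k₀ → ℤ) → Set
OddDominant {p} {k₀} φ = (s s' : S p k₀) → proj₁ s < proj₁ s' → Regular {p} {k₀} φ s s'

ConsecRegular : ∀ {p k₀} → (S p k₀ → ℤ) → Set
ConsecRegular {p} {k₀} φ = (s₁ s₂ : S p k₀) → proj₁ s₂ ≡ suc (proj₁ s₁) → Regular {p} {k₀} φ s₁ s₂

-- Regularity of a pair only depends on the two values, and as a relation on ℤ it is
-- transitive: if φ s = φ t or φ t = φ u, the pair (s, u) inherits regularity from the
-- other step, and otherwise φ t and φ u are odd integers at distance at most 1, hence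
-- equal.
module Submission where

open import Defs
open import Data.Nat as ℕ using (ℕ; suc; _≤_; _<_; _≤′_; ≤′-refl; ≤′-step; s≤s)
open import Data.Nat.Properties using (≤-trans; ≤-reflexive; n≤1+n; <⇒≤; <⇒<′; ≤′⇒≤; m≤n+m)
open import Data.Nat.Primality using (Prime)
open import Data.Integer as ℤ using (ℤ; ∣_∣; _-_; _≟_)
open import Data.Integer.Properties using (abs-*; ∣i∣≡0⇒i≡0; i-j≡0⇒i≡j)
open import Data.Integer.Tactic.RingSolver using (solve-∀)
open import Data.Product using (Σ; _×_; _,_; proj₁; proj₂)
open import Function.Bundles using (_⇔_; mk⇔)
open import Relation.Binary.Core using (Rel)
open import Relation.Binary.Definitions using (Transitive)
open import Relation.Binary.PropositionalEquality using (_≡_; _≢_; refl; sym; trans; cong; subst)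
open import Relation.Nullary using (yes; no; contradiction)

double≤1⇒≡0 : ∀ n → 2 ℕ.* n ≤ 1 → n ≡ 0
double≤1⇒≡0 0       _ = refl
double≤1⇒≡0 (suc n) (s≤s h) = contradiction (≤-trans (m≤n+m _ n) h) λ ()

odd-diff : ∀ k m → (ℤ.+ 1 ℤ.+ ℤ.+ 2 ℤ.* k) - (ℤ.+ 1 ℤ.+ ℤ.+ 2 ℤ.* m) ≡ ℤ.+ 2 ℤ.* (k - m)
odd-diff = solve-∀

odd-∣-∣≤1⇒≡ : ∀ {a b} → OddInt a → OddInt b → ∣ a - b ∣ ≤ 1 → a ≡ b
odd-∣-∣≤1⇒≡ (k , refl) (m , refl) dist≤1 =
  cong (λ x → ℤ.+ 1 ℤ.+ ℤ.+ 2 ℤ.* x) (i-j≡0⇒i≡j k m (∣i∣≡0⇒i≡0 (double≤1⇒≡0 _ twice≤1)))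
  where
  twice≤1 : 2 ℕ.* ∣ k - m ∣ ≤ 1
  twice≤1 = subst (_≤ 1) (trans (cong ∣_∣ (odd-diff k m)) (abs-* (ℤ.+ 2) (k - m))) dist≤1

RegularValues : Rel ℤ _
RegularValues x y = (∣ x - y ∣ ≤ 1) × (x ≢ y → OddInt y)

RegularValues-trans : Transitive RegularValues
RegularValues-trans {x} {y} {z} x~y y~z with x ≟ y | y ≟ z
... | yes refl | _        = y~z
... | no _     | yes refl = x~y
... | no x≢y   | no y≢z   =
  contradiction (odd-∣-∣≤1⇒≡ (proj₂ x~y x≢y) (proj₂ y~z y≢z) (proj₁ y~z)) y≢z

Interval : ℕ → ℕ → Set
Interval lo hi = Σ ℕ λ s → lo ≤ s × s ≤ hi

module _ {a ℓ} {A : Set a} {lo hi : ℕ} (f : Interval lo hi → A)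
         (R : Rel A ℓ) (R-trans : Transitive R)
         (consecutive : (s t : Interval lo hi) → proj₁ t ≡ suc (proj₁ s) → R (f s) (f t))
         where

  consecutive⇒increasing : (s t : Interval lo hi) → proj₁ s < proj₁ t → R (f s) (f t)
  consecutive⇒increasing (m , lo≤m , m≤hi) (n , lo≤n , n≤hi) m<n =
    go lo≤m m≤hi (lo≤n , n≤hi) (<⇒<′ m<n)
    where
    go : ∀ {m n} (lo≤m : lo ≤ m) (m≤hi : m ≤ hi) (n∈ : lo ≤ n × n ≤ hi) →
         suc m ≤′ n → R (f (m , lo≤m , m≤hi)) (f (n , n∈))
    go lo≤m m≤hi n∈ ≤′-refl = consecutive _ _ refl
    go {m} {suc n} lo≤m m≤hi (_ , 1+n≤hi) (≤′-step m<′n) =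
      R-trans (go lo≤m m≤hi n∈ m<′n) (consecutive (n , n∈) _ refl)
      where
      n∈ : lo ≤ n × n ≤ hi
      n∈ = ≤-trans lo≤m (<⇒≤ (≤′⇒≤ m<′n)) , ≤-trans (n≤1+n n) 1+n≤hi

lemma3p16 : (p : ℕ) → Prime p → 7 ≤ p → (k₀ : ℕ) → 2 ≤ k₀ → k₀ ≤ p →
    (φ : S p k₀ → ℤ) → OddDominant {p} {k₀} φ ⇔ ConsecRegular {p} {k₀} φ
lemma3p16 p _ _ k₀ _ _ φ = mk⇔
  (λ dominant s t t≡1+s → dominant s t (≤-reflexive (sym t≡1+s)))
  (consecutive⇒increasing φ RegularValues RegularValues-trans)
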